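{- Let $(G,p)$ be a periodic framework in $\mathbb{R}^d$ with lattice vector $\ell$, and let $\hat V,\hat V'\subset V(G)$ be two representative vertex sets, with corresponding quotient frameworks $(\hat G,z,\hat p,\ell)$ and $(\hat G',z',\hat p',\ell)$. Identify the edge sets $\hat E(\hat G)^\circ$ and $\hat E(\hat G')^\circ$ with $(E\cup E_L)/\mathbb{Z}$ as described in the context. Then for every $\omega:(E\cup E_L)/\mathbb{Z}\to\mathbb{R}$, $\omega$ lies in the kernel of $R(\hat G,z,\hat p,\ell)^\top$ if and only if $\omega$ lies in the kernel of $R(\hat G',z',\hat p',\ell)^\top$.
   Context: A $\mathbb{Z}$-symmetric graph $G=(V,E)$ is a simple undirected graph with a free action of the additive group $\mathbb{Z}$ by automorphisms ($v\mapsto v+\gamma$) with finitely many vertex and edge orbits. A representative vertex set $\hat V\subset V$ contains exactly one vertex from each vertex orbit. Each edge orbit is then $\{\{i+\beta,j+\beta+\gamma\}:\beta\in\mathbb{Z}\}$ for some $i,j\in\hat V$, $\gamma\in\mathbb{Z}$, recorded as a directed edge $(i,j;\gamma)$ with label $z(e)=\gamma$; this gives the quotient $\mathbb{Z}$-labelled graph $(\hat G,z)$ (a finite directed multigraph with edge labels), whose edges correspond bijectively to edge orbits $E/\mathbb{Z}$ (the orientation of an edge may be reversed, negating its label). Add a new symbol $L$ and a new selfloop $e_L$ at $L$ with label $1$; write $\hat E^\circ=\hat E\cup\{e_L\}$, and identify $e_L$ with an extra symbol $E_L$, so $\hat E^\circ$ is identified with $(E\cup E_L)/\mathbb{Z}$.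 For nonzero $\ell\in\mathbb{R}^d$, an $\ell$-periodic framework is $p:V\to\mathbb{R}^d$ with $p(v+1)-p(v)=\ell$ for all $v$. With $\hat V=\{1,\dots,n\}$ and $\hat p=p|_{\hat V}$, the quadruple $(\hat G,z,\hat p,\ell)$ is the quotient framework. For $e=(i,j;z(e))\in\hat E$ let $v_e=\hat p(j)+z(e)\ell-\hat p(i)$, and let $v_{e_L}=\ell$. The rigidity matrix $R(\hat G,z,\hat p,\ell)$ is the $|\hat E^\circ|\times d(n+1)$ matrix whose columns are grouped into $n+1$ blocks of $d$ consecutive columns (one per vertex $1,\dots,n$, and a last block for $L$); the row of $e=(i,j;z(e))\in\hat E$ has $-v_e^\top$ in block $i$, $v_e^\top$ in block $j$ (these two contributions added if $i=j$), $z(e)v_e^\top$ in block $L$, and zeros elsewhere; the row of $e_L$ has $v_{e_L}^\top$ in block $L$ and zeros elsewhere. A map $\omega$ on $(E\cup E_L)/\mathbb{Z}$ is viewed as a vector in $\mathbb{R}^{\hat E^\circ}$. -}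

module Defs where

open import Level using (0ℓ)
open import Algebra.Bundles using (CommutativeRing)
open import Data.Nat using (ℕ; zero; suc)
open import Data.Integer as ℤ using (ℤ; +_; -[1+_])
open import Data.Fin using (Fin; zero; suc; _≟_)
open import Data.Maybe using (Maybe; just; nothing)
open import Data.Bool using (if_then_else_)
open import Data.Product using (Σ; _×_; _,_)
open import Data.Sum using (_⊎_)
open import Data.Empty using (⊥)
open import Relation.Nullary using (¬_)
open import Relation.Nullary.Decidable using (⌊_⌋)
open import Relation.Binary.PropositionalEquality using (_≡_)

-- Scalars.  The paper works over ℝ, which agda-stdlib lacks; we use an
-- arbitrary field.

record Field : Set₁ where
  field
    commRing : CommutativeRing 0ℓ 0ℓ
  open CommutativeRing commRing public
  field
    0≉1 : ¬ (0# ≈ 1#)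
    inverse : ∀ x → ¬ (x ≈ 0#) → Σ Carrier (λ y → (x * y) ≈ 1#)

SameEdge : {V : Set} → V × V → V × V → Set
SameEdge (u , v) (u' , v') = (u ≡ u' × v ≡ v') ⊎ (u ≡ v' × v ≡ u')

-- A ℤ-symmetric graph: a simple undirected graph with a free ℤ-action by
-- automorphisms and finitely many edge orbits, enumerated as
-- orbit k = { {eu k + β , ev k + β} : β ∈ ℤ },  k : Fin m.
-- (Finiteness of the vertex orbits is witnessed by the existence of a
-- representative vertex set, see RepSet, which the theorem assumes.)

record ZSymGraph : Set₁ where
  field
    V     : Set
    _+ᵥ_  : V → ℤ → V
    act-zero  : ∀ v → v +ᵥ (+ 0) ≡ v
    act-assoc : ∀ v a b → (v +ᵥ a) +ᵥ b ≡ v +ᵥ (a ℤ.+ b)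
    act-free  : ∀ v a → v +ᵥ a ≡ v → a ≡ + 0
    Adj       : V → V → Set
    Adj-sym     : ∀ {u v} → Adj u v → Adj v u
    Adj-irrefl  : ∀ {v} → Adj v v → ⊥
    Adj-act     : ∀ {u v} γ → Adj u v → Adj (u +ᵥ γ) (v +ᵥ γ)
    m     : ℕ
    eu ev : Fin m → V
    e-adj : ∀ k → Adj (eu k) (ev k)
    e-cover  : ∀ u v → Adj u v →
               Σ (Fin m) (λ k → Σ ℤ (λ β →
                 SameEdge (u , v) (eu k +ᵥ β , ev k +ᵥ β)))
    e-unique : ∀ k k' β β' →
               SameEdge (eu k +ᵥ β , ev k +ᵥ β) (eu k' +ᵥ β' , ev k' +ᵥ β') →
               k ≡ k'

record RepSet (G : ZSymGraph) (n : ℕ) : Set where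
  open ZSymGraph G
  field
    rep    : Fin n → V
    cover  : ∀ v → Σ (Fin n) (λ i → Σ ℤ (λ a → rep i +ᵥ a ≡ v))
    unique : ∀ i j a b → rep i +ᵥ a ≡ rep j +ᵥ b → i ≡ j

-- A quotient ℤ-labelled graph (Ĝ , z) w.r.t. a representative set:
-- edge orbit k is recorded as the directed edge (i , j ; γ) = q k, meaning
-- orbit k = { {rep i + β , rep j + β + γ} : β ∈ ℤ }.

IsQuotient : (G : ZSymGraph) {n : ℕ} → RepSet G n →
             (Fin (ZSymGraph.m G) → Fin n × Fin n × ℤ) → Set
IsQuotient G R q = ∀ k → Cond (q k) k
  where
  open ZSymGraph G
  open RepSet R
  Cond : _ → Fin m → Set
  Cond (i , j , γ) k =
    Σ ℤ (λ β → SameEdge (rep i +ᵥ β , rep j +ᵥ (β ℤ.+ γ)) (eu k , ev k))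

module Rigidity (F : Field) where
  open Field F hiding (zero)

  Pt : ℕ → Set
  Pt d = Fin d → Carrier

  fromℕ : ℕ → Carrier
  fromℕ zero    = 0#
  fromℕ (suc k) = 1# + fromℕ k

  fromℤ : ℤ → Carrier
  fromℤ (+ k)      = fromℕ k
  fromℤ -[1+ k ]   = - fromℕ (suc k)

  Σ[_] : (k : ℕ) → (Fin k → Carrier) → Carrier
  Σ[ zero ]  f = 0#
  Σ[ suc k ] f = f zero + Σ[ k ] (λ i → f (suc i))

  NonZeroVec : ∀ {d} → Pt d → Set
  NonZeroVec ℓ = ¬ (∀ c → ℓ c ≈ 0#)

  IsPeriodic : (G : ZSymGraph) {d : ℕ} → (ZSymGraph.V G → Pt d) → Pt d → Set
  IsPeriodic G p ℓ = ∀ v c → (p (v +ᵥ (+ 1)) c - p v c) ≈ ℓ c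
    where open ZSymGraph G

  edgeVec : ∀ {n d} → (Fin n → Pt d) → Pt d → Fin n × Fin n × ℤ → Pt d
  edgeVec p̂ ℓ (i , j , γ) c = (p̂ j c + fromℤ γ * ℓ c) - p̂ i c

  -- Rows: Fin (suc m), where row zero is the
  -- loop e_L and row (suc k) is the edge orbit k.  Columns: a block
  -- (just i for vertex i, nothing for L) and a coordinate c : Fin d.
  rigidityMatrix : ∀ {n m d} → (Fin m → Fin n × Fin n × ℤ) →
                   (Fin n → Pt d) → Pt d →
                   Fin (suc m) → Maybe (Fin n) → Fin d → Carrier
  rigidityMatrix q p̂ ℓ zero    (just b) c = 0#
  rigidityMatrix q p̂ ℓ zero    nothing  c = ℓ c
  rigidityMatrix q p̂ ℓ (suc k) (just b) c with q k
  ... | (i , j , γ) =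
        (if ⌊ b ≟ j ⌋ then edgeVec p̂ ℓ (i , j , γ) c else 0#)
      + (if ⌊ b ≟ i ⌋ then - edgeVec p̂ ℓ (i , j , γ) c else 0#)
  rigidityMatrix q p̂ ℓ (suc k) nothing  c with q k
  ... | (i , j , γ) = fromℤ γ * edgeVec p̂ ℓ (i , j , γ) c

  InKerTranspose : ∀ {n m d} →
                   (Fin (suc m) → Maybe (Fin n) → Fin d → Carrier) →
                   (Fin (suc m) → Carrier) → Set
  InKerTranspose {m = m} M ω =
    ∀ b c → Σ[ suc m ] (λ r → ω r * M r b c) ≈ 0#

{-# OPTIONS --safe #-}
module Submission where

-- Relative to a representative set, write every vertex x as rep (orbit x) +ᵥ height x.
-- By periodicity, p (x +ᵥ a) = p x + a ℓ, so the row of the edge orbit of {u, v} in the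
-- quotient rigidity matrix depends on the representative set only through orbit and
-- height: its vertex part is the signed incidence vector of (orbit u, orbit v) scaled by
-- p v - p u, and its L entry is (height v - height u) (p v - p u).  Changing the
-- representative set relabels the vertex columns injectively and shifts each height by
-- an offset depending only on the orbit, so the L column changes by a linear combination
-- of vertex columns.  Hence a vector orthogonal to all columns of one matrix is
-- orthogonal to all columns of the other, i.e. the kernels of the transposes agree.

open import Defs
open import Data.Nat as ℕ using (ℕ; zero; suc)
open import Data.Integer as ℤ using (ℤ; +_; -[1+_]; _⊖_)
import Data.Integer.Properties as ℤ
import Data.Nat.Properties as ℕ
open import Data.Fin using (Fin; zero; suc; _≟_)
import Data.Fin.Properties as Fin
open import Data.Bool using (true; false; if_then_else_)
open import Data.Maybe using (Maybe; just; nothing)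
import Data.Sign as Sign
open import Data.Product using (_×_; _,_; proj₁; proj₂)
open import Data.Sum using (inj₁; inj₂)
open import Data.Vec.Functional using (Vector)
open import Function.Base using (_∘_)
open import Function.Bundles using (_⇔_; mk⇔)
open import Function.Definitions using (Injective)
open import Relation.Nullary using (yes; no; contradiction)
open import Relation.Nullary.Decidable using (⌊_⌋)
open import Relation.Binary.PropositionalEquality as ≡ using (_≡_)

does-≟-injective : ∀ {n n'} {f : Fin n' → Fin n} → Injective _≡_ _≡_ f →
                   ∀ a b → ⌊ f a ≟ f b ⌋ ≡ ⌊ a ≟ b ⌋
does-≟-injective {f = f} f-inj a b with f a ≟ f b | a ≟ b
... | yes _      | yes _   = ≡.refl
... | yes fa≡fb  | no a≢b  = contradiction (f-inj fa≡fb) a≢b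
... | no fa≢fb   | yes a≡b = contradiction (≡.cong f a≡b) fa≢fb
... | no _       | no _    = ≡.refl

module FromℤHomomorphism (F : Field) where
  open Field F hiding (zero)
  open Rigidity F
  open import Algebra.Properties.Ring ring using (-‿involutive; -0#≈0#; -‿distribˡ-*; -‿distribʳ-*)
  open import Algebra.Properties.AbelianGroup +-abelianGroup using (⁻¹-∙-comm)
  open import Algebra.Properties.CommutativeSemigroup +-commutativeSemigroup using (interchange)
  import Algebra.Solver.Ring
  import Algebra.Solver.Ring.AlmostCommutativeRing as ACR
  open import Relation.Binary.Reasoning.Setoid setoid

  fromℕ-+ : ∀ m n → fromℕ (m ℕ.+ n) ≈ fromℕ m + fromℕ n
  fromℕ-+ zero    n = sym (+-identityˡ _)
  fromℕ-+ (suc m) n = trans (+-congˡ (fromℕ-+ m n)) (sym (+-assoc _ _ _))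

  fromℕ-* : ∀ m n → fromℕ (m ℕ.* n) ≈ fromℕ m * fromℕ n
  fromℕ-* zero    n = sym (zeroˡ _)
  fromℕ-* (suc m) n = begin
    fromℕ (n ℕ.+ m ℕ.* n)             ≈⟨ fromℕ-+ n (m ℕ.* n) ⟩
    fromℕ n + fromℕ (m ℕ.* n)         ≈⟨ +-cong (sym (*-identityˡ _)) (fromℕ-* m n) ⟩
    1# * fromℕ n + fromℕ m * fromℕ n  ≈⟨ distribʳ _ _ _ ⟨
    (1# + fromℕ m) * fromℕ n          ∎

  fromℤ-⊖ : ∀ m n → fromℤ (m ⊖ n) ≈ fromℕ m - fromℕ n
  fromℤ-⊖ m       zero    = sym (trans (+-congˡ -0#≈0#) (+-identityʳ _))
  fromℤ-⊖ zero    (suc n) = sym (+-identityˡ _)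
  fromℤ-⊖ (suc m) (suc n) rewrite ℤ.[1+m]⊖[1+n]≡m⊖n m n = begin
    fromℤ (m ⊖ n)                           ≈⟨ fromℤ-⊖ m n ⟩
    fromℕ m - fromℕ n                       ≈⟨ +-identityˡ _ ⟨
    0# + (fromℕ m - fromℕ n)                ≈⟨ +-congʳ (-‿inverseʳ 1#) ⟨
    (1# - 1#) + (fromℕ m + - fromℕ n)       ≈⟨ interchange _ _ _ _ ⟩
    (1# + fromℕ m) + (- 1# + - fromℕ n)     ≈⟨ +-congˡ (⁻¹-∙-comm _ _) ⟩
    (1# + fromℕ m) - (1# + fromℕ n)         ∎

  fromℤ-+ : ∀ i j → fromℤ (i ℤ.+ j) ≈ fromℤ i + fromℤ j
  fromℤ-+ (+ m)    (+ n)    = fromℕ-+ m n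
  fromℤ-+ (+ m)    -[1+ n ] = fromℤ-⊖ m (suc n)
  fromℤ-+ -[1+ m ] (+ n)    = trans (fromℤ-⊖ n (suc m)) (+-comm _ _)
  fromℤ-+ -[1+ m ] -[1+ n ] = begin
    - fromℕ (suc (suc (m ℕ.+ n)))        ≡⟨ ≡.cong (λ k → - fromℕ (suc k)) (ℕ.+-suc m n) ⟨
    - fromℕ (suc m ℕ.+ suc n)            ≈⟨ -‿cong (fromℕ-+ (suc m) (suc n)) ⟩
    - (fromℕ (suc m) + fromℕ (suc n))    ≈⟨ ⁻¹-∙-comm _ _ ⟨
    - fromℕ (suc m) + - fromℕ (suc n)    ∎

  fromℤ-neg : ∀ i → fromℤ (ℤ.- i) ≈ - fromℤ i
  fromℤ-neg (+ zero)  = sym -0#≈0#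
  fromℤ-neg (+ suc n) = refl
  fromℤ-neg -[1+ n ]  = sym (-‿involutive _)

  fromℤ-◃⁺ : ∀ n → fromℤ (Sign.+ ℤ.◃ n) ≈ fromℕ n
  fromℤ-◃⁺ zero    = refl
  fromℤ-◃⁺ (suc n) = refl

  fromℤ-◃⁻ : ∀ n → fromℤ (Sign.- ℤ.◃ n) ≈ - fromℕ n
  fromℤ-◃⁻ zero    = sym -0#≈0#
  fromℤ-◃⁻ (suc n) = refl

  fromℤ-* : ∀ i j → fromℤ (i ℤ.* j) ≈ fromℤ i * fromℤ j
  fromℤ-* (+ m)    (+ n)    = trans (fromℤ-◃⁺ (m ℕ.* n)) (fromℕ-* m n)
  fromℤ-* (+ m)    -[1+ n ] = begin
    fromℤ (Sign.- ℤ.◃ (m ℕ.* suc n))    ≈⟨ fromℤ-◃⁻ (m ℕ.* suc n) ⟩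
    - fromℕ (m ℕ.* suc n)               ≈⟨ -‿cong (fromℕ-* m (suc n)) ⟩
    - (fromℕ m * fromℕ (suc n))          ≈⟨ -‿distribʳ-* _ _ ⟩
    fromℕ m * - fromℕ (suc n)            ∎
  fromℤ-* -[1+ m ] (+ n)    = begin
    fromℤ (Sign.- ℤ.◃ (suc m ℕ.* n))    ≈⟨ fromℤ-◃⁻ (suc m ℕ.* n) ⟩
    - fromℕ (suc m ℕ.* n)               ≈⟨ -‿cong (fromℕ-* (suc m) n) ⟩
    - (fromℕ (suc m) * fromℕ n)          ≈⟨ -‿distribˡ-* _ _ ⟩
    - fromℕ (suc m) * fromℕ n            ∎
  fromℤ-* -[1+ m ] -[1+ n ] = begin
    fromℤ (Sign.+ ℤ.◃ (suc m ℕ.* suc n))  ≈⟨ fromℤ-◃⁺ (suc m ℕ.* suc n) ⟩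
    fromℕ (suc m ℕ.* suc n)               ≈⟨ fromℕ-* (suc m) (suc n) ⟩
    a * b                                 ≈⟨ -‿involutive _ ⟨
    - - (a * b)                           ≈⟨ -‿cong (-‿distribˡ-* _ _) ⟩
    - (- a * b)                           ≈⟨ -‿distribʳ-* _ _ ⟩
    - a * - b                             ∎
    where
    a b : Carrier
    a = fromℕ (suc m)
    b = fromℕ (suc n)

  fromℤ-homomorphism : ℤ.+-*-rawRing ACR.-Raw-AlmostCommutative⟶ ACR.fromCommutativeRing commRing
  fromℤ-homomorphism = record
    { ⟦_⟧ = fromℤ ; +-homo = fromℤ-+ ; *-homo = fromℤ-* ; -‿homo = fromℤ-neg
    ; 0-homo = refl ; 1-homo = +-identityʳ 1# }

  fromℤ-≈? : ∀ i j → Maybe (fromℤ i ≈ fromℤ j)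
  fromℤ-≈? i j with i ℤ.≟ j
  ... | yes ≡.refl = just refl
  ... | no _       = nothing

  module Solver = Algebra.Solver.Ring ℤ.+-*-rawRing (ACR.fromCommutativeRing commRing) fromℤ-homomorphism fromℤ-≈?

module Orthogonality (F : Field) where
  open Field F hiding (zero)
  open Rigidity F
  open import Algebra.Properties.CommutativeSemigroup *-commutativeSemigroup using (x∙yz≈y∙xz)
  open import Algebra.Properties.Semiring.Sum semiring
    using (sum; sum-syntax; sum-cong-≋; sum-replicate-zero; ∑-distrib-+; ∑-comm; *-distribˡ-sum)
  open import Relation.Binary.Reasoning.Setoid setoid

  Σ≡sum : ∀ k (f : Vector Carrier k) → Σ[ k ] f ≡ sum f
  Σ≡sum zero    f = ≡.refl
  Σ≡sum (suc k) f = ≡.cong (λ s → f zero + s) (Σ≡sum k (f ∘ suc))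

  infix 7 _·_
  infix 4 _⊥_

  _·_ : ∀ {k} → Vector Carrier k → Vector Carrier k → Carrier
  _·_ {k} u v = ∑[ r < k ] (u r * v r)

  _⊥_ : ∀ {k} → Vector Carrier k → Vector Carrier k → Set
  u ⊥ v = u · v ≈ 0#

  ⊥-respʳ : ∀ {k} {u v w : Vector Carrier k} → (∀ r → v r ≈ w r) → u ⊥ v → u ⊥ w
  ⊥-respʳ v≈w u⊥v = trans (sum-cong-≋ (λ r → *-congˡ (sym (v≈w r)))) u⊥v

  ⊥-cancelʳ : ∀ {k} {u v w : Vector Carrier k} → u ⊥ (λ r → v r + w r) → u ⊥ w → u ⊥ v
  ⊥-cancelʳ {k} {u} {v} {w} u⊥v+w u⊥w = begin
    u · v                               ≈⟨ +-identityʳ _ ⟨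
    u · v + 0#                          ≈⟨ +-congˡ u⊥w ⟨
    u · v + u · w                       ≈⟨ ∑-distrib-+ {k} (λ r → u r * v r) (λ r → u r * w r) ⟨
    ∑[ r < k ] (u r * v r + u r * w r)  ≈⟨ sum-cong-≋ {k} (λ r → distribˡ _ _ _) ⟨
    u · (λ r → v r + w r)               ≈⟨ u⊥v+w ⟩
    0#                                  ∎

  ·-∑ : ∀ {k n} (u : Vector Carrier k) (a : Vector Carrier n) (vs : Fin n → Vector Carrier k) →
        u · (λ r → ∑[ b < n ] (a b * vs b r)) ≈ ∑[ b < n ] (a b * (u · vs b))
  ·-∑ {k} {n} u a vs = begin
    u · (λ r → ∑[ b < n ] (a b * vs b r))            ≈⟨ sum-cong-≋ {k} (λ r → *-distribˡ-sum {n} (u r) _) ⟩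
    ∑[ r < k ] ∑[ b < n ] (u r * (a b * vs b r))     ≈⟨ ∑-comm {k} {n} _ ⟩
    ∑[ b < n ] ∑[ r < k ] (u r * (a b * vs b r))     ≈⟨ sum-cong-≋ {n} (λ b → sum-cong-≋ {k} (λ r → x∙yz≈y∙xz _ _ _)) ⟩
    ∑[ b < n ] ∑[ r < k ] (a b * (u r * vs b r))     ≈⟨ sum-cong-≋ {n} (λ b → *-distribˡ-sum {k} (a b) _) ⟨
    ∑[ b < n ] (a b * (u · vs b))                    ∎

  ⊥-linearCombination : ∀ {k n} {u : Vector Carrier k} (a : Vector Carrier n) (vs : Fin n → Vector Carrier k) →
                        (∀ b → u ⊥ vs b) → u ⊥ (λ r → ∑[ b < n ] (a b * vs b r))
  ⊥-linearCombination {n = n} {u} a vs u⊥vs = begin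
    u · (λ r → ∑[ b < n ] (a b * vs b r)) ≈⟨ ·-∑ u a vs ⟩
    ∑[ b < n ] (a b * (u · vs b))         ≈⟨ sum-cong-≋ {n} (λ b → trans (*-congˡ (u⊥vs b)) (zeroʳ _)) ⟩
    ∑[ b < n ] 0#                         ≈⟨ sum-replicate-zero n ⟩
    0#                                    ∎

  InKerTranspose⇒⊥ : ∀ {n m d} (M : Fin (suc m) → Maybe (Fin n) → Fin d → Carrier) ω →
                     InKerTranspose M ω → ∀ b c → ω ⊥ (λ r → M r b c)
  InKerTranspose⇒⊥ {m = m} M ω H b c = ≡.subst (_≈ 0#) (Σ≡sum (suc m) (λ r → ω r * M r b c)) (H b c)

  ⊥⇒InKerTranspose : ∀ {n m d} (M : Fin (suc m) → Maybe (Fin n) → Fin d → Carrier) ω →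
                     (∀ b c → ω ⊥ (λ r → M r b c)) → InKerTranspose M ω
  ⊥⇒InKerTranspose {m = m} M ω H b c = ≡.subst (_≈ 0#) (≡.sym (Σ≡sum (suc m) (λ r → ω r * M r b c))) (H b c)

module Incidence (F : Field) where
  open Field F hiding (zero)
  open import Algebra.Properties.Ring ring using (-‿involutive)
  open import Algebra.Properties.Semiring.Sum semiring
    using (sum-syntax; sum-cong-≋; sum-replicate-zero; ∑-distrib-+)
  open FromℤHomomorphism.Solver F using (solve; _:+_; _:*_; :-_; _:-_; _:=_)
  open import Relation.Binary.Reasoning.Setoid setoid

  incidence : ∀ {n} → Fin n → Fin n → Fin n → Carrier → Carrier
  incidence b i j v = (if ⌊ b ≟ j ⌋ then v else 0#) + (if ⌊ b ≟ i ⌋ then - v else 0#)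

  if-then-congˡ : ∀ t {x y z} → x ≈ y → (if t then x else z) ≈ (if t then y else z)
  if-then-congˡ true  x≈y = x≈y
  if-then-congˡ false x≈y = refl

  incidence-cong : ∀ {n} (b i j : Fin n) {v w} → v ≈ w → incidence b i j v ≈ incidence b i j w
  incidence-cong b i j v≈w =
    +-cong (if-then-congˡ ⌊ b ≟ j ⌋ v≈w) (if-then-congˡ ⌊ b ≟ i ⌋ (-‿cong v≈w))

  incidence-reverse : ∀ {n} (b i j : Fin n) {v w} → v ≈ - w → incidence b j i v ≈ incidence b i j w
  incidence-reverse b i j {v} {w} v≈-w = trans
    (+-cong (if-then-congˡ ⌊ b ≟ i ⌋ v≈-w)
            (if-then-congˡ ⌊ b ≟ j ⌋ (trans (-‿cong v≈-w) (-‿involutive w))))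
    (+-comm _ _)

  incidence-relabel : ∀ {n n'} {f : Fin n' → Fin n} → Injective _≡_ _≡_ f →
                      ∀ b i j v → incidence (f b) (f i) (f j) v ≡ incidence b i j v
  incidence-relabel f-inj b i j v =
    ≡.cong₂ (λ s t → (if s then v else 0#) + (if t then - v else 0#))
      (does-≟-injective f-inj b j) (does-≟-injective f-inj b i)

  ∑-select : ∀ {n} (a : Vector Carrier n) x v → ∑[ b < n ] (a b * (if ⌊ b ≟ x ⌋ then v else 0#)) ≈ a x * v
  ∑-select {suc n} a zero v = begin
    a zero * v + ∑[ b < n ] (a (suc b) * 0#) ≈⟨ +-congˡ (sum-cong-≋ {n} (λ b → zeroʳ _)) ⟩
    a zero * v + ∑[ b < n ] 0#               ≈⟨ +-congˡ (sum-replicate-zero n) ⟩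
    a zero * v + 0#                          ≈⟨ +-identityʳ _ ⟩
    a zero * v                               ∎
  ∑-select {suc n} a (suc x) v = begin
    a zero * 0# + ∑[ b < n ] (a (suc b) * (if ⌊ suc b ≟ suc x ⌋ then v else 0#))
      ≈⟨ +-cong (zeroʳ _) (sum-cong-≋ {n} λ b → reflexive
           (≡.cong (λ t → a (suc b) * (if t then v else 0#)) (does-≟-injective Fin.suc-injective b x))) ⟩
    0# + ∑[ b < n ] (a (suc b) * (if ⌊ b ≟ x ⌋ then v else 0#))
      ≈⟨ +-identityˡ _ ⟩
    ∑[ b < n ] (a (suc b) * (if ⌊ b ≟ x ⌋ then v else 0#))
      ≈⟨ ∑-select (a ∘ suc) x v ⟩
    a (suc x) * v
      ∎

  ∑-incidence : ∀ {n} (a : Vector Carrier n) i j v → ∑[ b < n ] (a b * incidence b i j v) ≈ (a j - a i) * v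
  ∑-incidence {n} a i j v = begin
    ∑[ b < n ] (a b * incidence b i j v)
      ≈⟨ sum-cong-≋ {n} (λ b → distribˡ _ _ _) ⟩
    ∑[ b < n ] (a b * (if ⌊ b ≟ j ⌋ then v else 0#) + a b * (if ⌊ b ≟ i ⌋ then - v else 0#))
      ≈⟨ ∑-distrib-+ {n} _ _ ⟩
    ∑[ b < n ] (a b * (if ⌊ b ≟ j ⌋ then v else 0#)) + ∑[ b < n ] (a b * (if ⌊ b ≟ i ⌋ then - v else 0#))
      ≈⟨ +-cong (∑-select a j v) (∑-select a i (- v)) ⟩
    a j * v + a i * - v
      ≈⟨ solve 3 (λ x y z → x :* z :+ y :* (:- z) := (x :- y) :* z) refl (a j) (a i) v ⟩
    (a j - a i) * v
      ∎

module Orbits (G : ZSymGraph) where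
  open ZSymGraph G
  open ≡.≡-Reasoning

  +ᵥ-inverse : ∀ v a → (v +ᵥ a) +ᵥ (ℤ.- a) ≡ v
  +ᵥ-inverse v a = begin
    (v +ᵥ a) +ᵥ (ℤ.- a)   ≡⟨ act-assoc v a (ℤ.- a) ⟩
    v +ᵥ (a ℤ.- a)        ≡⟨ ≡.cong (v +ᵥ_) (ℤ.+-inverseʳ a) ⟩
    v +ᵥ (+ 0)            ≡⟨ act-zero v ⟩
    v                     ∎

  +ᵥ-cancelˡ : ∀ v {a b} → v +ᵥ a ≡ v +ᵥ b → a ≡ b
  +ᵥ-cancelˡ v {a} {b} v+a≡v+b = ℤ.i-j≡0⇒i≡j a b (act-free v (a ℤ.- b) (begin
    v +ᵥ (a ℤ.- b)          ≡⟨ act-assoc v a (ℤ.- b) ⟨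
    (v +ᵥ a) +ᵥ (ℤ.- b)     ≡⟨ ≡.cong (_+ᵥ (ℤ.- b)) v+a≡v+b ⟩
    (v +ᵥ b) +ᵥ (ℤ.- b)     ≡⟨ +ᵥ-inverse v b ⟩
    v                       ∎))

  module _ {n} (R : RepSet G n) where
    open RepSet R

    orbit : V → Fin n
    orbit x = proj₁ (cover x)

    height : V → ℤ
    height x = proj₁ (proj₂ (cover x))

    rep-orbit-height : ∀ x → rep (orbit x) +ᵥ height x ≡ x
    rep-orbit-height x = proj₂ (proj₂ (cover x))

    orbit-unique : ∀ {i β x} → rep i +ᵥ β ≡ x → orbit x ≡ i
    orbit-unique {i} {β} {x} rep-i+β≡x =
      unique (orbit x) i (height x) β (≡.trans (rep-orbit-height x) (≡.sym rep-i+β≡x))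

    height-unique : ∀ {i β x} → rep i +ᵥ β ≡ x → height x ≡ β
    height-unique {i} {β} {x} rep-i+β≡x = +ᵥ-cancelˡ (rep i) (begin
      rep i +ᵥ height x          ≡⟨ ≡.cong (λ j → rep j +ᵥ height x) (orbit-unique rep-i+β≡x) ⟨
      rep (orbit x) +ᵥ height x  ≡⟨ rep-orbit-height x ⟩
      x                          ≡⟨ rep-i+β≡x ⟨
      rep i +ᵥ β                 ∎)

  module ChangeOfRepresentatives {n n'} (R : RepSet G n) (R' : RepSet G n') where
    open RepSet R using (rep)
    open RepSet R' using () renaming (rep to rep'; unique to unique')

    relabel : Fin n' → Fin n
    relabel b = orbit R (rep' b)

    offset : Fin n' → ℤ
    offset b = height R (rep' b)

    rep-relabel-offset : ∀ x → rep (relabel (orbit R' x)) +ᵥ (offset (orbit R' x) ℤ.+ height R' x) ≡ x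
    rep-relabel-offset x = begin
      rep (relabel b) +ᵥ (offset b ℤ.+ height R' x)   ≡⟨ act-assoc _ _ _ ⟨
      (rep (relabel b) +ᵥ offset b) +ᵥ height R' x    ≡⟨ ≡.cong (_+ᵥ height R' x) (rep-orbit-height R (rep' b)) ⟩
      rep' b +ᵥ height R' x                           ≡⟨ rep-orbit-height R' x ⟩
      x                                               ∎
      where b = orbit R' x

    orbit-relabel : ∀ x → orbit R x ≡ relabel (orbit R' x)
    orbit-relabel x = orbit-unique R (rep-relabel-offset x)

    height-offset : ∀ x → height R x ≡ offset (orbit R' x) ℤ.+ height R' x
    height-offset x = height-unique R (rep-relabel-offset x)

    rep-relabel : ∀ b → rep' b +ᵥ (ℤ.- offset b) ≡ rep (relabel b)
    rep-relabel b = begin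
      rep' b +ᵥ (ℤ.- offset b)                          ≡⟨ ≡.cong (_+ᵥ (ℤ.- offset b)) (rep-orbit-height R (rep' b)) ⟨
      (rep (relabel b) +ᵥ offset b) +ᵥ (ℤ.- offset b)   ≡⟨ +ᵥ-inverse _ _ ⟩
      rep (relabel b)                                   ∎

    relabel-injective : Injective _≡_ _≡_ relabel
    relabel-injective {a} {b} relabel-a≡relabel-b = unique' a b (ℤ.- offset a) (ℤ.- offset b)
      (≡.trans (rep-relabel a) (≡.trans (≡.cong rep relabel-a≡relabel-b) (≡.sym (rep-relabel b))))

module PeriodicFramework (F : Field) (G : ZSymGraph) {d : ℕ}
  (p : ZSymGraph.V G → Rigidity.Pt F d) (ℓ : Rigidity.Pt F d)
  (periodic : Rigidity.IsPeriodic F G p ℓ) where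
  open Field F hiding (zero)
  open Rigidity F
  open FromℤHomomorphism F
  open Orthogonality F
  open Incidence F
  open ZSymGraph G
  open Orbits G
  open Solver using (solve; _:+_; _:*_; :-_; _:-_; _:=_)
  open import Algebra.Properties.Semiring.Sum semiring using (sum-syntax; sum-cong-≋; sum-replicate-zero)
  open import Relation.Binary.Reasoning.Setoid setoid

  p-+ᵥ-1 : ∀ v c → p (v +ᵥ (+ 1)) c ≈ p v c + ℓ c
  p-+ᵥ-1 v c = begin
    p (v +ᵥ (+ 1)) c                    ≈⟨ solve 2 (λ x y → x := y :+ (x :- y)) refl _ _ ⟩
    p v c + (p (v +ᵥ (+ 1)) c - p v c)  ≈⟨ +-congˡ (periodic v c) ⟩
    p v c + ℓ c                         ∎

  p-+ᵥ-ℕ : ∀ v k c → p (v +ᵥ (+ k)) c ≈ p v c + fromℕ k * ℓ c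
  p-+ᵥ-ℕ v zero    c = begin
    p (v +ᵥ (+ 0)) c        ≡⟨ ≡.cong (λ w → p w c) (act-zero v) ⟩
    p v c                   ≈⟨ +-identityʳ _ ⟨
    p v c + 0#              ≈⟨ +-congˡ (zeroˡ _) ⟨
    p v c + 0# * ℓ c        ∎
  p-+ᵥ-ℕ v (suc k) c = begin
    p (v +ᵥ (+ suc k)) c                  ≡⟨ ≡.cong (λ w → p w c) (act-assoc v (+ 1) (+ k)) ⟨
    p ((v +ᵥ (+ 1)) +ᵥ (+ k)) c            ≈⟨ p-+ᵥ-ℕ (v +ᵥ (+ 1)) k c ⟩
    p (v +ᵥ (+ 1)) c + fromℕ k * ℓ c       ≈⟨ +-congʳ (p-+ᵥ-1 v c) ⟩
    (p v c + ℓ c) + fromℕ k * ℓ c          ≈⟨ +-assoc _ _ _ ⟩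
    p v c + (ℓ c + fromℕ k * ℓ c)          ≈⟨ +-congˡ (+-congʳ (*-identityˡ _)) ⟨
    p v c + (1# * ℓ c + fromℕ k * ℓ c)     ≈⟨ +-congˡ (distribʳ _ _ _) ⟨
    p v c + fromℕ (suc k) * ℓ c            ∎

  p-+ᵥ : ∀ v a c → p (v +ᵥ a) c ≈ p v c + fromℤ a * ℓ c
  p-+ᵥ v (+ k)    c = p-+ᵥ-ℕ v k c
  p-+ᵥ v -[1+ k ] c = begin
    p w c
      ≈⟨ solve 3 (λ x y l → x := (x :+ y :* l) :+ (:- y) :* l) refl _ _ _ ⟩
    (p w c + fromℕ (suc k) * ℓ c) + - fromℕ (suc k) * ℓ c
      ≈⟨ +-congʳ (p-+ᵥ-ℕ w (suc k) c) ⟨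
    p (w +ᵥ (+ suc k)) c + - fromℕ (suc k) * ℓ c
      ≡⟨ ≡.cong (λ u → p u c + - fromℕ (suc k) * ℓ c) (+ᵥ-inverse v -[1+ k ]) ⟩
    p v c + - fromℕ (suc k) * ℓ c
      ∎
    where
    w : V
    w = v +ᵥ -[1+ k ]

  edgeVec-endpoints : ∀ {n} (R : RepSet G n) {i j γ β x y} c →
                      RepSet.rep R i +ᵥ β ≡ x → RepSet.rep R j +ᵥ (β ℤ.+ γ) ≡ y →
                      edgeVec (λ i → p (RepSet.rep R i)) ℓ (i , j , γ) c ≈ p y c - p x c
  edgeVec-endpoints R {i} {j} {γ} {β} c ≡.refl ≡.refl = begin
    (p (rep j) c + fromℤ γ * ℓ c) - p (rep i) c
      ≈⟨ solve 5 (λ a b f g l → (a :+ g :* l) :- b := (a :+ (f :+ g) :* l) :- (b :+ f :* l)) refl _ _ _ _ _ ⟩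
    (p (rep j) c + (fromℤ β + fromℤ γ) * ℓ c) - (p (rep i) c + fromℤ β * ℓ c)
      ≈⟨ +-cong (+-congˡ (*-congʳ (fromℤ-+ β γ))) (-‿cong (p-+ᵥ (rep i) β c)) ⟨
    (p (rep j) c + fromℤ (β ℤ.+ γ) * ℓ c) - p (rep i +ᵥ β) c
      ≈⟨ +-congʳ (p-+ᵥ (rep j) (β ℤ.+ γ) c) ⟨
    p (rep j +ᵥ (β ℤ.+ γ)) c - p (rep i +ᵥ β) c
      ∎
    where open RepSet R using (rep)

  quotientMatrix : ∀ {n} → RepSet G n → (Fin m → Fin n × Fin n × ℤ) →
                   Fin (suc m) → Maybe (Fin n) → Fin d → Carrier
  quotientMatrix R q = rigidityMatrix q (λ i → p (RepSet.rep R i)) ℓ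

  displacement : Fin m → Pt d
  displacement k c = p (ev k) c - p (eu k) c

  module QuotientRows {n} (R : RepSet G n) (q : Fin m → Fin n × Fin n × ℤ) (Q : IsQuotient G R q) where
    open RepSet R using (rep)

    vertexEntry-oriented : ∀ {i j γ β x y} b c → rep i +ᵥ β ≡ x → rep j +ᵥ (β ℤ.+ γ) ≡ y →
      incidence b i j (edgeVec (λ i → p (rep i)) ℓ (i , j , γ) c) ≈ incidence b (orbit R x) (orbit R y) (p y c - p x c)
    vertexEntry-oriented b c ex ey rewrite orbit-unique R ex | orbit-unique R ey =
      incidence-cong b _ _ (edgeVec-endpoints R c ex ey)

    loopEntry-oriented : ∀ {i j γ β x y} c → rep i +ᵥ β ≡ x → rep j +ᵥ (β ℤ.+ γ) ≡ y →
      fromℤ γ * edgeVec (λ i → p (rep i)) ℓ (i , j , γ) c ≈ (fromℤ (height R y) - fromℤ (height R x)) * (p y c - p x c)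
    loopEntry-oriented {γ = γ} {β} c ex ey rewrite height-unique R ex | height-unique R ey =
      *-cong γ≈[β+γ]-β (edgeVec-endpoints R c ex ey)
      where
      γ≈[β+γ]-β : fromℤ γ ≈ fromℤ (β ℤ.+ γ) - fromℤ β
      γ≈[β+γ]-β = trans (solve 2 (λ b g → g := (b :+ g) :- b) refl (fromℤ β) (fromℤ γ))
                        (+-congʳ (sym (fromℤ-+ β γ)))

    vertexEntry : ∀ k b c → quotientMatrix R q (suc k) (just b) c ≈
                            incidence b (orbit R (eu k)) (orbit R (ev k)) (displacement k c)
    vertexEntry k b c with q k | Q k
    ... | _ | _ , inj₁ (ex , ey) = vertexEntry-oriented b c ex ey
    ... | _ | _ , inj₂ (ex , ey) = trans (vertexEntry-oriented b c ex ey)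
      (incidence-reverse b _ _ (solve 2 (λ x y → x :- y := :- (y :- x)) refl _ _))

    loopEntry : ∀ k c → quotientMatrix R q (suc k) nothing c ≈
                        (fromℤ (height R (ev k)) - fromℤ (height R (eu k))) * displacement k c
    loopEntry k c with q k | Q k
    ... | _ | _ , inj₁ (ex , ey) = loopEntry-oriented c ex ey
    ... | _ | _ , inj₂ (ex , ey) = trans (loopEntry-oriented c ex ey)
      (solve 4 (λ a b x y → (a :- b) :* (x :- y) := (b :- a) :* (y :- x)) refl _ _ _ _)

  module _ {n n'} (R : RepSet G n) (R' : RepSet G n')
           (q : Fin m → Fin n × Fin n × ℤ) (Q : IsQuotient G R q)
           (q' : Fin m → Fin n' × Fin n' × ℤ) (Q' : IsQuotient G R' q') where
    open ChangeOfRepresentatives R R'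
    private
      M  : Fin (suc m) → Maybe (Fin n) → Fin d → Carrier
      M  = quotientMatrix R q
      M' : Fin (suc m) → Maybe (Fin n') → Fin d → Carrier
      M' = quotientMatrix R' q'

    vertexColumn-relabel : ∀ r b' c → M' r (just b') c ≈ M r (just (relabel b')) c
    vertexColumn-relabel zero    b' c = refl
    vertexColumn-relabel (suc k) b' c = begin
      M' (suc k) (just b') c
        ≈⟨ QuotientRows.vertexEntry R' q' Q' k b' c ⟩
      incidence b' (orbit R' (eu k)) (orbit R' (ev k)) (displacement k c)
        ≡⟨ incidence-relabel relabel-injective b' _ _ _ ⟨
      incidence (relabel b') (relabel (orbit R' (eu k))) (relabel (orbit R' (ev k))) (displacement k c)
        ≡⟨ ≡.cong₂ (λ i j → incidence (relabel b') i j (displacement k c)) (orbit-relabel (eu k)) (orbit-relabel (ev k)) ⟨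
      incidence (relabel b') (orbit R (eu k)) (orbit R (ev k)) (displacement k c)
        ≈⟨ QuotientRows.vertexEntry R q Q k (relabel b') c ⟨
      M (suc k) (just (relabel b')) c
        ∎

    loopColumn-offset : ∀ r c → M r nothing c ≈
                                M' r nothing c + ∑[ b' < n' ] (fromℤ (offset b') * M' r (just b') c)
    loopColumn-offset zero    c = begin
      ℓ c                                          ≈⟨ +-identityʳ _ ⟨
      ℓ c + 0#                                     ≈⟨ +-congˡ (sum-replicate-zero n') ⟨
      ℓ c + ∑[ b' < n' ] 0#                        ≈⟨ +-congˡ (sum-cong-≋ {n'} (λ b' → zeroʳ _)) ⟨
      ℓ c + ∑[ b' < n' ] (fromℤ (offset b') * 0#)  ∎
    loopColumn-offset (suc k) c = begin
      M (suc k) nothing c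
        ≈⟨ QuotientRows.loopEntry R q Q k c ⟩
      (fromℤ (height R (ev k)) - fromℤ (height R (eu k))) * D
        ≈⟨ *-congʳ (+-cong (fromℤ-height (ev k)) (-‿cong (fromℤ-height (eu k)))) ⟩
      ((o (ev k) + h' (ev k)) - (o (eu k) + h' (eu k))) * D
        ≈⟨ solve 5 (λ a b x y z → ((a :+ x) :- (b :+ y)) :* z := (x :- y) :* z :+ (a :- b) :* z) refl _ _ _ _ _ ⟩
      (h' (ev k) - h' (eu k)) * D + (o (ev k) - o (eu k)) * D
        ≈⟨ +-cong (QuotientRows.loopEntry R' q' Q' k c) (∑-incidence (fromℤ ∘ offset) _ _ D) ⟨
      M' (suc k) nothing c + ∑[ b' < n' ] (fromℤ (offset b') * incidence b' (orbit R' (eu k)) (orbit R' (ev k)) D)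
        ≈⟨ +-congˡ (sum-cong-≋ {n'} (λ b' → *-congˡ (QuotientRows.vertexEntry R' q' Q' k b' c))) ⟨
      M' (suc k) nothing c + ∑[ b' < n' ] (fromℤ (offset b') * M' (suc k) (just b') c)
        ∎
      where
      D : Carrier
      D = displacement k c
      o h' : V → Carrier
      o x  = fromℤ (offset (orbit R' x))
      h' x = fromℤ (height R' x)
      fromℤ-height : ∀ x → fromℤ (height R x) ≈ o x + h' x
      fromℤ-height x = trans (reflexive (≡.cong fromℤ (height-offset x)))
                             (fromℤ-+ (offset (orbit R' x)) (height R' x))

    ⊥-columns-relabel : ∀ ω → (∀ b c → ω ⊥ (λ r → M r b c)) → (∀ b' c → ω ⊥ (λ r → M' r b' c))
    ⊥-columns-relabel ω ω⊥M (just b') c =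
      ⊥-respʳ {u = ω} (λ r → sym (vertexColumn-relabel r b' c)) (ω⊥M (just (relabel b')) c)
    ⊥-columns-relabel ω ω⊥M nothing   c =
      ⊥-cancelʳ {u = ω} {v = λ r → M' r nothing c} {w = offsetCombination}
        (⊥-respʳ {u = ω} (λ r → loopColumn-offset r c) (ω⊥M nothing c))
        (⊥-linearCombination {u = ω} (fromℤ ∘ offset) (λ b' r → M' r (just b') c)
          (λ b' → ⊥-columns-relabel ω ω⊥M (just b') c))
      where
      offsetCombination : Vector Carrier (suc m)
      offsetCombination r = ∑[ b' < n' ] (fromℤ (offset b') * M' r (just b') c)

    InKerTranspose-relabel : ∀ ω → InKerTranspose M ω → InKerTranspose M' ω
    InKerTranspose-relabel ω =
      ⊥⇒InKerTranspose M' ω ∘ ⊥-columns-relabel ω ∘ InKerTranspose⇒⊥ M ω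

lemma5p1 : (F : Field) (G : ZSymGraph) (d : ℕ) →
    (p : ZSymGraph.V G → Rigidity.Pt F d) (ℓ : Rigidity.Pt F d) →
    Rigidity.NonZeroVec F ℓ → Rigidity.IsPeriodic F G p ℓ →
    {n n' : ℕ} (R : RepSet G n) (R' : RepSet G n') →
    (q : Fin (ZSymGraph.m G) → Fin n × Fin n × ℤ) → IsQuotient G R q →
    (q' : Fin (ZSymGraph.m G) → Fin n' × Fin n' × ℤ) → IsQuotient G R' q' →
    (ω : Fin (suc (ZSymGraph.m G)) → Field.Carrier F) →
    Rigidity.InKerTranspose F (Rigidity.rigidityMatrix F q (λ i → p (RepSet.rep R i)) ℓ) ω
      ⇔ Rigidity.InKerTranspose F (Rigidity.rigidityMatrix F q' (λ i → p (RepSet.rep R' i)) ℓ) ω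
lemma5p1 F G d p ℓ _ periodic R R' q Q q' Q' ω =
  mk⇔ (InKerTranspose-relabel R R' q Q q' Q' ω) (InKerTranspose-relabel R' R q' Q' q Q ω)
  where open PeriodicFramework F G p ℓ periodic
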